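{- Let $n\ge 3$ and $i\in\{1,2\}$. Among all $2$-connected simple graphs on $n$ vertices: (i) if $G$ maximizes $\Pi_i(G)$, then $G$ is the complete graph $K_n$; (ii) if $G$ minimizes $\Pi_i(G)$, then $G$ is the cycle $C_n$.
   Context: For a graph $G$ with vertex degrees $d(u)$: $\Pi_1(G)=\prod_{u\in V(G)} d(u)^2$ and $\Pi_2(G)=\prod_{uv\in E(G)} d(u)d(v)=\prod_{u\in V(G)} d(u)^{d(u)}$. A graph is $2$-connected if it is connected and has no vertex whose removal disconnects it. -}

module Defs where

open import Data.Nat using (ℕ; zero; suc; _^_)
open import Data.Fin using (Fin; toℕ)
open import Data.Bool using (Bool; true; false; if_then_else_)
open import Data.List using (List; map; allFin)
open import Data.Nat.ListAction using (sum; product)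
open import Data.Unit using (⊤)
open import Data.Product using (Σ; _×_)
open import Data.Sum using (_⊎_)
open import Relation.Binary.PropositionalEquality using (_≡_; _≢_)
open import Function.Bundles using (_↔_; _⇔_; Inverse)

record Graph (n : ℕ) : Set where
  field
    adj    : Fin n → Fin n → Bool
    sym    : ∀ u v → adj u v ≡ adj v u
    irrefl : ∀ u → adj u u ≡ false
open Graph public

degree : ∀ {n} → Graph n → Fin n → ℕ
degree {n} G u = sum (map (λ v → if adj G u v then 1 else 0) (allFin n))

Π₁ : ∀ {n} → Graph n → ℕ
Π₁ {n} G = product (map (λ u → degree G u ^ 2) (allFin n))

-- Π₂(G) = ∏_{uv ∈ E} d(u) d(v) = ∏_u d(u)^{d(u)}
Π₂ : ∀ {n} → Graph n → ℕ
Π₂ {n} G = product (map (λ u → degree G u ^ degree G u) (allFin n))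

data Idx : Set where
  i₁ i₂ : Idx

Π : Idx → ∀ {n} → Graph n → ℕ
Π i₁ G = Π₁ G
Π i₂ G = Π₂ G

data Walk {n : ℕ} (G : Graph n) (allowed : Fin n → Set) : Fin n → Fin n → Set where
  here : ∀ {u} → allowed u → Walk G allowed u u
  step : ∀ {u w v} → allowed u → adj G u w ≡ true → Walk G allowed w v → Walk G allowed u v

Connected : ∀ {n} → Graph n → Set
Connected G = ∀ u v → Walk G (λ _ → ⊤) u v

NoCutVertex : ∀ {n} → Graph n → Set
NoCutVertex G = ∀ w u v → u ≢ w → v ≢ w → Walk G (λ x → x ≢ w) u v

TwoConnected : ∀ {n} → Graph n → Set
TwoConnected G = Connected G × NoCutVertex G

IsComplete : ∀ {n} → Graph n → Set
IsComplete G = ∀ u v → u ≢ v → adj G u v ≡ true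

CycleAdj : (n : ℕ) → Fin n → Fin n → Set
CycleAdj n a b =
  (suc (toℕ a) ≡ toℕ b) ⊎ (suc (toℕ b) ≡ toℕ a)
  ⊎ ((toℕ a ≡ 0 × suc (toℕ b) ≡ n) ⊎ (toℕ b ≡ 0 × suc (toℕ a) ≡ n))

IsCycle : ∀ {n} → Graph n → Set
IsCycle {n} G = Σ (Fin n ↔ Fin n) λ σ →
  ∀ a b → (adj G (Inverse.to σ a) (Inverse.to σ b) ≡ true) ⇔ CycleAdj n a b

module Submission where

-- Both indices are products over vertices of an increasing weight of the
-- degree (d ↦ d² resp. d ↦ dᵈ), so they are governed by degrees alone.
-- Every vertex of a 2-connected graph on ≥ 3 vertices has two distinct
-- neighbours, hence degree ≥ 2.
--  (i)  Adding a missing edge keeps 2-connectivity and raises the degrees of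
--       its endpoints, so it strictly increases Π; a maximiser is complete.
--  (ii) The standard cycle C_n is 2-connected with all degrees 2, so a
--       minimiser has Π ≤ (weight 2)ⁿ and thus no vertex of degree ≥ 3.
--       A connected graph in which every vertex has exactly two neighbours
--       is a cycle: follow a non-backtracking trail until it closes up.

open import Defs renaming (sym to adj-sym)
open import Data.Nat using (ℕ; zero; suc; _+_; _*_; _^_; _≤_; _<_; z≤n; s≤s; s≤s⁻¹; _≤?_)
open import Data.Nat.Properties hiding (_≟_)
import Data.Nat.Properties as ℕ
open import Data.Nat.ListAction using (sum; product)
open import Data.Fin using (Fin; zero; suc; toℕ; fromℕ<; fromℕ; punchIn)
open import Data.Fin.Properties
  using (_≟_; any?; injective⇒≤; punchInᵢ≢i; punchIn-injective; punchIn-punchOut;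
         toℕ-fromℕ<; fromℕ<-toℕ; toℕ<n; toℕ-injective; toℕ-fromℕ)
open import Data.List using (map; allFin; tabulate; foldr)
open import Data.List.Properties using (map-tabulate)
import Data.Vec.Functional as Vector
import Algebra.Properties.CommutativeMonoid.Sum as MonoidSum
open import Data.Bool using (Bool; true; false; if_then_else_; _∨_; _∧_)
open import Data.Bool.Properties using (∨-comm; ∧-comm)
open import Data.Product using (Σ; _×_; _,_; proj₁; proj₂)
open import Data.Sum using (_⊎_; inj₁; inj₂)
open import Data.Unit using (tt)
open import Data.Empty using (⊥; ⊥-elim)
open import Function using (_∘_)
open import Function.Bundles using (_↔_; mk↔ₛ′; mk⇔)
open import Relation.Nullary using (¬_; Dec; yes; no; does)
open import Relation.Nullary.Decidable using (_×-dec_; _⊎-dec_; dec-true; dec-false; does-⇔)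
open import Relation.Binary.Definitions using (tri<; tri≈; tri>)
open import Relation.Binary.PropositionalEquality

module ∑ℕ = MonoidSum +-0-commutativeMonoid
module ∏ℕ = MonoidSum *-1-commutativeMonoid

∑ ∏ : ∀ {n} → (Fin n → ℕ) → ℕ
∑ = ∑ℕ.sum
∏ = ∏ℕ.sum

foldr-tabulate : ∀ {n} (_∙_ : ℕ → ℕ → ℕ) (e : ℕ) (f : Fin n → ℕ) →
                 foldr _∙_ e (tabulate f) ≡ Vector.foldr _∙_ e f
foldr-tabulate {zero}  _∙_ e f = refl
foldr-tabulate {suc n} _∙_ e f = cong (f zero ∙_) (foldr-tabulate _∙_ e (f ∘ suc))

sum-allFin : ∀ {n} (f : Fin n → ℕ) → sum (map f (allFin n)) ≡ ∑ f
sum-allFin f = trans (cong sum (map-tabulate (λ x → x) f)) (foldr-tabulate _+_ 0 f)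

product-allFin : ∀ {n} (f : Fin n → ℕ) → product (map f (allFin n)) ≡ ∏ f
product-allFin f = trans (cong product (map-tabulate (λ x → x) f)) (foldr-tabulate _*_ 1 f)

∑-mono : ∀ {n} {h h′ : Fin n → ℕ} → (∀ x → h x ≤ h′ x) → ∑ h ≤ ∑ h′
∑-mono {zero}  le = z≤n
∑-mono {suc n} le = +-mono-≤ (le zero) (∑-mono (le ∘ suc))

∏-mono : ∀ {n} {h h′ : Fin n → ℕ} → (∀ x → h x ≤ h′ x) → ∏ h ≤ ∏ h′
∏-mono {zero}  le = ≤-refl
∏-mono {suc n} le = *-mono-≤ (le zero) (∏-mono (le ∘ suc))

∏-positive : ∀ {n} {h : Fin n → ℕ} → (∀ x → 1 ≤ h x) → 1 ≤ ∏ h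
∏-positive {zero}  pos = ≤-refl
∏-positive {suc n} pos = *-mono-≤ (pos zero) (∏-positive (pos ∘ suc))

∏-const : ∀ n c → ∏ {n} (λ _ → c) ≡ c ^ n
∏-const zero    c = refl
∏-const (suc n) c = cong (c *_) (∏-const n c)

∑-strict : ∀ {n} {h h′ : Fin n → ℕ} → (∀ x → h x ≤ h′ x) →
           ∀ a → h a < h′ a → ∑ h < ∑ h′
∑-strict {suc n} {h} {h′} le a lt
  rewrite ∑ℕ.sum-remove {i = a} h | ∑ℕ.sum-remove {i = a} h′ =
  +-mono-<-≤ lt (∑-mono (le ∘ punchIn a))

∏-strict : ∀ {n} {h h′ : Fin n → ℕ} → (∀ x → 1 ≤ h x) → (∀ x → h x ≤ h′ x) →
           ∀ a → h a < h′ a → ∏ h < ∏ h′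
∏-strict {suc n} {h} {h′} pos le a lt
  rewrite ∏ℕ.sum-remove {i = a} h | ∏ℕ.sum-remove {i = a} h′ =
  *-mono-<-≤ lt (∏-mono (le ∘ punchIn a)) (∏-positive (pos ∘ punchIn a))
  where
  *-mono-<-≤ : ∀ {a b c d} → a < b → c ≤ d → 1 ≤ c → a * c < b * d
  *-mono-<-≤ {a} {b} {c} a<b c≤d 1≤c =
    ≤-trans (+-monoˡ-≤ (a * c) 1≤c) (≤-trans (*-monoˡ-≤ c a<b) (*-monoʳ-≤ b c≤d))

Distinct₃ : {A : Set} → A → A → A → Set
Distinct₃ a b c = a ≢ b × a ≢ c × b ≢ c

∑-point : ∀ {n} (h : Fin n → ℕ) a → h a ≤ ∑ h
∑-point {suc n} h a rewrite ∑ℕ.sum-remove {i = a} h = m≤m+n (h a) _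

∑-pair : ∀ {n} (h : Fin n → ℕ) {a b} → a ≢ b → h a + h b ≤ ∑ h
∑-pair {suc n} h {a} {b} a≢b rewrite ∑ℕ.sum-remove {i = a} h =
  +-monoʳ-≤ (h a) (subst (λ y → h y ≤ _) (punchIn-punchOut a≢b) (∑-point (h ∘ punchIn a) _))

∑-triple : ∀ {n} (h : Fin n → ℕ) {a b c} → Distinct₃ a b c →
           h a + (h b + h c) ≤ ∑ h
∑-triple {suc n} h {a} {b} {c} (a≢b , a≢c , b≢c) rewrite ∑ℕ.sum-remove {i = a} h =
  +-monoʳ-≤ (h a) (subst₂ (λ y z → h y + h z ≤ _)
    (punchIn-punchOut a≢b) (punchIn-punchOut a≢c)
    (∑-pair (h ∘ punchIn a) (λ b′≡c′ → b≢c (trans (sym (punchIn-punchOut a≢b))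
                                     (trans (cong (punchIn a) b′≡c′) (punchIn-punchOut a≢c))))))

∑-support : ∀ {n} (h : Fin n → ℕ) → 1 ≤ ∑ h → Σ (Fin n) λ x → 1 ≤ h x
∑-support {suc n} h pos with h zero in eq
... | suc _ = zero , subst (1 ≤_) (sym eq) (s≤s z≤n)
... | zero  with ∑-support (h ∘ suc) pos
...   | x , hx = suc x , hx

∑-peel : ∀ {n m} (h : Fin (suc n) → ℕ) → (∀ x → h x ≤ 1) → suc m ≤ ∑ h →
         Σ (Fin (suc n)) λ a → 1 ≤ h a × m ≤ ∑ (h ∘ punchIn a)
∑-peel {m = m} h ≤1 m<∑ with ∑-support h (≤-trans (s≤s z≤n) m<∑)
... | a , ha = a , ha , s≤s⁻¹ (begin
  suc m                       ≤⟨ m<∑ ⟩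
  ∑ h                         ≡⟨ ∑ℕ.sum-remove {i = a} h ⟩
  h a + ∑ (h ∘ punchIn a)     ≤⟨ +-monoˡ-≤ _ (≤1 a) ⟩
  suc (∑ (h ∘ punchIn a))     ∎)
  where open ≤-Reasoning

support-triple : ∀ {n} (h : Fin (3 + n) → ℕ) → (∀ x → h x ≤ 1) → 3 ≤ ∑ h →
                 Σ (Fin (3 + n)) λ a → Σ (Fin (3 + n)) λ b → Σ (Fin (3 + n)) λ c →
                 Distinct₃ a b c × 1 ≤ h a × 1 ≤ h b × 1 ≤ h c
support-triple h ≤1 3≤∑ with ∑-peel h ≤1 3≤∑
... | a , ha , 2≤∑′ with ∑-peel (h ∘ punchIn a) (≤1 ∘ punchIn a) 2≤∑′
... | b , hb , 1≤∑″ with ∑-support (h ∘ punchIn a ∘ punchIn b) 1≤∑″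
... | c , hc = a , punchIn a b , punchIn a (punchIn b c) , distinct , ha , hb , hc
  where
  distinct : Distinct₃ a (punchIn a b) (punchIn a (punchIn b c))
  distinct = (λ e → punchInᵢ≢i a b (sym e))
           , (λ e → punchInᵢ≢i a (punchIn b c) (sym e))
           , (λ e → punchInᵢ≢i b c (sym (punchIn-injective a _ _ e)))

edge : ∀ {n} → Graph n → Fin n → Fin n → ℕ
edge G u v = if adj G u v then 1 else 0

degree-∑ : ∀ {n} (G : Graph n) u → degree G u ≡ ∑ (edge G u)
degree-∑ G u = sum-allFin (edge G u)

edge≤1 : ∀ {n} (G : Graph n) u v → edge G u v ≤ 1
edge≤1 G u v with adj G u v
... | true  = ≤-refl
... | false = z≤n

edge-adj : ∀ {n} (G : Graph n) {u v} → adj G u v ≡ true → edge G u v ≡ 1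
edge-adj G e rewrite e = refl

adj-edge : ∀ {n} (G : Graph n) {u v} → 1 ≤ edge G u v → adj G u v ≡ true
adj-edge G {u} {v} p with adj G u v
... | true  = refl
... | false = ⊥-elim (1+n≰n p)

adj-≢ : ∀ {n} (G : Graph n) {u v} → adj G u v ≡ true → u ≢ v
adj-≢ G {u} e refl with trans (sym e) (irrefl G u)
... | ()

degree-pair : ∀ {n} (G : Graph n) u {a b} → a ≢ b →
              adj G u a ≡ true → adj G u b ≡ true → 2 ≤ degree G u
degree-pair G u a≢b ea eb rewrite degree-∑ G u =
  subst₂ (λ x y → x + y ≤ ∑ (edge G u)) (edge-adj G ea) (edge-adj G eb) (∑-pair (edge G u) a≢b)

degree-triple : ∀ {n} (G : Graph n) u {a b c} → Distinct₃ a b c →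
                adj G u a ≡ true → adj G u b ≡ true → adj G u c ≡ true → 3 ≤ degree G u
degree-triple G u d ea eb ec rewrite degree-∑ G u =
  subst₂ (λ x y → x + y ≤ ∑ (edge G u)) (edge-adj G ea) (cong₂ _+_ (edge-adj G eb) (edge-adj G ec))
    (∑-triple (edge G u) d)

triple-neighbours : ∀ {k} (G : Graph (3 + k)) u → 3 ≤ degree G u →
  Σ (Fin (3 + k)) λ a → Σ (Fin (3 + k)) λ b → Σ (Fin (3 + k)) λ c →
  Distinct₃ a b c × adj G u a ≡ true × adj G u b ≡ true × adj G u c ≡ true
triple-neighbours G u 3≤d rewrite degree-∑ G u
  with support-triple (edge G u) (edge≤1 G u) 3≤d
... | a , b , c , d , ea , eb , ec = a , b , c , d , adj-edge G ea , adj-edge G eb , adj-edge G ec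

weight : Idx → ℕ → ℕ
weight i₁ d = d ^ 2
weight i₂ d = d ^ d

Π-∏ : ∀ i {n} (G : Graph n) → Π i G ≡ ∏ (λ u → weight i (degree G u))
Π-∏ i₁ G = product-allFin (λ u → weight i₁ (degree G u))
Π-∏ i₂ G = product-allFin (λ u → weight i₂ (degree G u))

weight-strict : ∀ i {d d′} → 1 ≤ d → d < d′ → weight i d < weight i d′
weight-strict i₁ _   d<d′ = ^-monoˡ-< 2 d<d′
weight-strict i₂ {d} {d′} 1≤d d<d′ =
  ≤-<-trans (^-monoˡ-≤ d (<⇒≤ d<d′)) (^-monoʳ-< d′ (≤-trans (s≤s 1≤d) d<d′) d<d′)

weight-mono : ∀ i {d d′} → 1 ≤ d → d ≤ d′ → weight i d ≤ weight i d′
weight-mono i 1≤d d≤d′ with m≤n⇒m<n∨m≡n d≤d′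
... | inj₁ d<d′ = <⇒≤ (weight-strict i 1≤d d<d′)
... | inj₂ refl = ≤-refl

weight-positive : ∀ i {d} → 1 ≤ d → 1 ≤ weight i d
weight-positive i₁ 1≤d = weight-mono i₁ ≤-refl 1≤d
weight-positive i₂ 1≤d = weight-mono i₂ ≤-refl 1≤d

record _⊆ᴳ_ {n} (G H : Graph n) : Set where
  constructor subgraph
  field edge-of : ∀ {a b} → adj G a b ≡ true → adj H a b ≡ true
open _⊆ᴳ_

walk-start : ∀ {n} {G : Graph n} {Q : Fin n → Set} {u v} → Walk G Q u v → Q u
walk-start (here q)     = q
walk-start (step q _ _) = q

walk-map : ∀ {n} {G H : Graph n} {Q Q′ : Fin n → Set} → G ⊆ᴳ H → (∀ x → Q x → Q′ x) →
           ∀ {u v} → Walk G Q u v → Walk H Q′ u v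
walk-map G⊆H Q⊆Q′ (here q)     = here (Q⊆Q′ _ q)
walk-map G⊆H Q⊆Q′ (step q e w) = step (Q⊆Q′ _ q) (edge-of G⊆H e) (walk-map G⊆H Q⊆Q′ w)

_++ʷ_ : ∀ {n} {G : Graph n} {Q : Fin n → Set} {u v w} →
        Walk G Q u v → Walk G Q v w → Walk G Q u w
here _     ++ʷ w₂ = w₂
step q e w ++ʷ w₂ = step q e (w ++ʷ w₂)

reverseʷ : ∀ {n} {G : Graph n} {Q : Fin n → Set} {u v} → Walk G Q u v → Walk G Q v u
reverseʷ (here q) = here q
reverseʷ {G = G} (step {u} {w} q e rest) =
  reverseʷ rest ++ʷ step (walk-start rest) (trans (adj-sym G w u) e) (here q)

first-step : ∀ {n} {G : Graph n} {Q : Fin n → Set} {u v} → Walk G Q u v → u ≢ v →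
             Σ (Fin n) λ w → adj G u w ≡ true × Q w
first-step (here _)        u≢u = ⊥-elim (u≢u refl)
first-step (step _ e rest) _   = _ , e , walk-start rest

third : ∀ {k} (a b : Fin (3 + k)) → Σ (Fin (3 + k)) λ c → c ≢ a × c ≢ b
third a b with zero ≟ a | zero ≟ b
... | no 0≢a   | no 0≢b   = zero , 0≢a , 0≢b
... | yes refl | yes refl = suc zero , (λ ()) , (λ ())
... | yes refl | no _ with suc zero ≟ b
...   | no 1≢b   = suc zero , (λ ()) , 1≢b
...   | yes refl = suc (suc zero) , (λ ()) , (λ ())
third a b | no _ | yes refl with suc zero ≟ a
...   | no 1≢a   = suc zero , 1≢a , (λ ())
...   | yes refl = suc (suc zero) , (λ ()) , (λ ())

-- In a 2-connected graph on at least three vertices every vertex u has two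
-- distinct neighbours: a first one w₁ on a walk to some other vertex, and a
-- second one on a walk avoiding w₁ to a vertex different from u and w₁.
two-neighbours : ∀ {k} (G : Graph (3 + k)) → TwoConnected G → ∀ u →
  Σ (Fin (3 + k)) λ w₁ → Σ (Fin (3 + k)) λ w₂ →
  w₁ ≢ w₂ × adj G u w₁ ≡ true × adj G u w₂ ≡ true
two-neighbours G (connected , noCut) u =
  let (v , v≢u , _)        = third u u
      (w₁ , e₁ , _)        = first-step (connected u v) (λ e → v≢u (sym e))
      (v′ , v′≢u , v′≢w₁)  = third u w₁
      (w₂ , e₂ , w₂≢w₁)    = first-step (noCut w₁ u v′ (adj-≢ G e₁) v′≢w₁) (λ e → v′≢u (sym e))
  in w₁ , w₂ , (λ e → w₂≢w₁ (sym e)) , e₁ , e₂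

degree≥2 : ∀ {k} (G : Graph (3 + k)) → TwoConnected G → ∀ u → 2 ≤ degree G u
degree≥2 G tc u with two-neighbours G tc u
... | w₁ , w₂ , w₁≢w₂ , e₁ , e₂ = degree-pair G u w₁≢w₂ e₁ e₂

twoConnected-⊆ : ∀ {n} {G H : Graph n} → G ⊆ᴳ H → TwoConnected G → TwoConnected H
twoConnected-⊆ G⊆H (connected , noCut) =
  (λ a b → walk-map G⊆H (λ _ q → q) (connected a b)) ,
  (λ w a b a≢w b≢w → walk-map G⊆H (λ _ q → q) (noCut w a b a≢w b≢w))

edge-⊆ : ∀ {n} {G H : Graph n} → G ⊆ᴳ H → ∀ x y → edge G x y ≤ edge H x y
edge-⊆ {G = G} {H} G⊆H x y with adj G x y in e
... | false = z≤n
... | true  = ≤-reflexive (sym (edge-adj H (edge-of G⊆H e)))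

degree-⊆ : ∀ {n} {G H : Graph n} → G ⊆ᴳ H → ∀ x → degree G x ≤ degree H x
degree-⊆ {G = G} {H} G⊆H x rewrite degree-∑ G x | degree-∑ H x = ∑-mono (edge-⊆ G⊆H x)

degree-⊂ : ∀ {n} {G H : Graph n} → G ⊆ᴳ H → ∀ {u v} →
           adj G u v ≡ false → adj H u v ≡ true → degree G u < degree H u
degree-⊂ {G = G} {H} G⊆H {u} {v} no-uv uv rewrite degree-∑ G u | degree-∑ H u =
  ∑-strict (edge-⊆ G⊆H u) v (subst₂ _<_ (sym edge-uv≡0) (sym (edge-adj H uv)) (s≤s z≤n))
  where
  edge-uv≡0 : edge G u v ≡ 0
  edge-uv≡0 rewrite no-uv = refl

Π-⊂ : ∀ i {n} {G H : Graph n} → (∀ x → 1 ≤ degree G x) → G ⊆ᴳ H → ∀ {u v} →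
      adj G u v ≡ false → adj H u v ≡ true → Π i G < Π i H
Π-⊂ i {G = G} {H} pos G⊆H {u} no-uv uv rewrite Π-∏ i G | Π-∏ i H =
  ∏-strict (λ x → weight-positive i (pos x))
           (λ x → weight-mono i (pos x) (degree-⊆ G⊆H x)) u
           (weight-strict i (pos u) (degree-⊂ G⊆H no-uv uv))

addEdge : ∀ {n} (G : Graph n) {u v : Fin n} → u ≢ v → Graph n
addEdge {n} G {u} {v} u≢v = record { adj = adj′ ; sym = sym′ ; irrefl = irrefl′ }
  where
  adj′ : Fin n → Fin n → Bool
  adj′ x y = adj G x y ∨ ((does (x ≟ u) ∧ does (y ≟ v)) ∨ (does (x ≟ v) ∧ does (y ≟ u)))

  sym′ : ∀ x y → adj′ x y ≡ adj′ y x
  sym′ x y rewrite adj-sym G x y =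
    cong (adj G y x ∨_) (trans (∨-comm (does (x ≟ u) ∧ does (y ≟ v)) _)
      (cong₂ _∨_ (∧-comm (does (x ≟ v)) _) (∧-comm (does (x ≟ u)) _)))

  irrefl′ : ∀ x → adj′ x x ≡ false
  irrefl′ x rewrite irrefl G x with x ≟ u | x ≟ v
  ... | yes refl | yes u≡v = ⊥-elim (u≢v u≡v)
  ... | yes _    | no _    = refl
  ... | no _     | yes _   = refl
  ... | no _     | no _    = refl

addEdge-⊇ : ∀ {n} (G : Graph n) {u v : Fin n} (u≢v : u ≢ v) → G ⊆ᴳ addEdge G u≢v
addEdge-⊇ G u≢v = subgraph λ e → cong (_∨ _) e

addEdge-new : ∀ {n} (G : Graph n) {u v : Fin n} (u≢v : u ≢ v) → adj (addEdge G u≢v) u v ≡ true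
addEdge-new G {u} {v} u≢v with adj G u v | u ≟ u | v ≟ v
... | true  | _        | _        = refl
... | false | yes _    | yes _    = refl
... | false | no u≢u   | _        = ⊥-elim (u≢u refl)
... | false | yes _    | no v≢v   = ⊥-elim (v≢v refl)

-- Part (i): a maximiser of Π i among 2-connected graphs is complete, since a
-- missing edge uv could be added, keeping 2-connectivity and increasing Π i.
maximiser-complete : ∀ {k} i (G : Graph (3 + k)) → TwoConnected G →
  ((H : Graph (3 + k)) → TwoConnected H → Π i H ≤ Π i G) → IsComplete G
maximiser-complete i G tc maximal u v u≢v with adj G u v in no-uv
... | true  = refl
... | false = ⊥-elim (<⇒≱ Π-increases (maximal (addEdge G u≢v) (twoConnected-⊆ G⊆G+uv tc)))
  where
  G⊆G+uv : G ⊆ᴳ addEdge G u≢v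
  G⊆G+uv = addEdge-⊇ G u≢v
  Π-increases : Π i G < Π i (addEdge G u≢v)
  Π-increases =
    Π-⊂ i (λ x → ≤-trans (s≤s z≤n) (degree≥2 G tc x)) G⊆G+uv no-uv (addEdge-new G u≢v)

no-triple-in-two-classes : {A : Set} (P R : A → Set) →
  (∀ {x y} → P x → P y → x ≡ y) → (∀ {x y} → R x → R y → x ≡ y) →
  ∀ {a b c} → Distinct₃ a b c → P a ⊎ R a → P b ⊎ R b → P c ⊎ R c → ⊥
no-triple-in-two-classes P R uniqueP uniqueR {a} {b} {c} (a≢b , a≢c , b≢c) = classify
  where
  classify : P a ⊎ R a → P b ⊎ R b → P c ⊎ R c → ⊥
  classify (inj₁ pa) (inj₁ pb) _         = a≢b (uniqueP pa pb)
  classify (inj₂ ra) (inj₂ rb) _         = a≢b (uniqueR ra rb)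
  classify (inj₁ pa) (inj₂ _)  (inj₁ pc) = a≢c (uniqueP pa pc)
  classify (inj₂ ra) (inj₁ _)  (inj₂ rc) = a≢c (uniqueR ra rc)
  classify (inj₁ _)  (inj₂ rb) (inj₂ rc) = b≢c (uniqueR rb rc)
  classify (inj₂ _)  (inj₁ pb) (inj₁ pc) = b≢c (uniqueP pb pc)

from-does : {A : Set} (a? : Dec A) → does a? ≡ true → A
from-does (yes a) _ = a
from-does (no _)  ()

module StandardCycle (k : ℕ) where
  N : ℕ
  N = 3 + k

  cycleAdj? : ∀ a b → Dec (CycleAdj N a b)
  cycleAdj? a b =
    (suc (toℕ a) ℕ.≟ toℕ b) ⊎-dec (suc (toℕ b) ℕ.≟ toℕ a) ⊎-dec
    ((toℕ a ℕ.≟ 0 ×-dec suc (toℕ b) ℕ.≟ N) ⊎-dec (toℕ b ℕ.≟ 0 ×-dec suc (toℕ a) ℕ.≟ N))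

  cycleAdj-sym : ∀ a b → CycleAdj N a b → CycleAdj N b a
  cycleAdj-sym a b (inj₁ e)               = inj₂ (inj₁ e)
  cycleAdj-sym a b (inj₂ (inj₁ e))        = inj₁ e
  cycleAdj-sym a b (inj₂ (inj₂ (inj₁ e))) = inj₂ (inj₂ (inj₂ e))
  cycleAdj-sym a b (inj₂ (inj₂ (inj₂ e))) = inj₂ (inj₂ (inj₁ e))

  cycleAdj-irrefl : ∀ a → ¬ CycleAdj N a a
  cycleAdj-irrefl a (inj₁ e)                      = 1+n≢n e
  cycleAdj-irrefl a (inj₂ (inj₁ e))               = 1+n≢n e
  cycleAdj-irrefl a (inj₂ (inj₂ (inj₁ (a≡0 , e)))) with () ← trans (cong suc (sym a≡0)) e
  cycleAdj-irrefl a (inj₂ (inj₂ (inj₂ (a≡0 , e)))) with () ← trans (cong suc (sym a≡0)) e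

  C : Graph N
  C = record { adj    = λ a b → does (cycleAdj? a b)
             ; sym    = λ a b → does-⇔ (mk⇔ (cycleAdj-sym a b) (cycleAdj-sym b a))
                                        (cycleAdj? a b) (cycleAdj? b a)
             ; irrefl = λ a → dec-false (cycleAdj? a a) (cycleAdj-irrefl a) }

  C-adj : ∀ {a b} → CycleAdj N a b → adj C a b ≡ true
  C-adj {a} {b} = dec-true (cycleAdj? a b)

  adj-C : ∀ {a b} → adj C a b ≡ true → CycleAdj N a b
  adj-C {a} {b} = from-does (cycleAdj? a b)

  C-adj-succ : ∀ {j} (j<N : j < N) (1+j<N : suc j < N) → adj C (fromℕ< j<N) (fromℕ< 1+j<N) ≡ true
  C-adj-succ j<N 1+j<N = C-adj (inj₁ (trans (cong suc (toℕ-fromℕ< j<N)) (sym (toℕ-fromℕ< 1+j<N))))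

  last : Fin N
  last = fromℕ (2 + k)

  C-adj-ends : adj C zero last ≡ true
  C-adj-ends = C-adj (inj₂ (inj₂ (inj₁ (refl , cong suc (toℕ-fromℕ (2 + k))))))

  ascend : (Q : Fin N → Set) → ∀ i j (i≤j : i ≤ j) (j<N : j < N) →
           (∀ l (l<N : l < N) → i ≤ l → l ≤ j → Q (fromℕ< l<N)) →
           Walk C Q (fromℕ< (≤-<-trans i≤j j<N)) (fromℕ< j<N)
  ascend Q i zero    z≤n   j<N q = here (q 0 j<N z≤n z≤n)
  ascend Q i (suc j) i≤1+j 1+j<N q with m≤n⇒m<n∨m≡n i≤1+j
  ... | inj₂ refl      = here (q (suc j) 1+j<N i≤1+j ≤-refl)
  ... | inj₁ (s≤s i≤j) =
    ascend Q i j i≤j j<N (λ l l<N i≤l l≤j → q l l<N i≤l (m≤n⇒m≤1+n l≤j))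
    ++ʷ step (q j j<N i≤j (n≤1+n j)) (C-adj-succ j<N 1+j<N) (here (q (suc j) 1+j<N i≤1+j ≤-refl))
    where
    j<N : j < N
    j<N = <-trans (n<1+n j) 1+j<N

  ascendᶠ : (Q : Fin N → Set) → ∀ u v → toℕ u ≤ toℕ v →
            (∀ x → toℕ u ≤ toℕ x → toℕ x ≤ toℕ v → Q x) → Walk C Q u v
  ascendᶠ Q u v u≤v q =
    subst₂ (Walk C Q) (fromℕ<-toℕ u _) (fromℕ<-toℕ v (toℕ<n v))
      (ascend Q (toℕ u) (toℕ v) u≤v (toℕ<n v) (λ l l<N u≤l l≤v →
        q (fromℕ< l<N) (subst (toℕ u ≤_) (sym (toℕ-fromℕ< l<N)) u≤l)
                       (subst (_≤ toℕ v) (sym (toℕ-fromℕ< l<N)) l≤v)))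

  C-connected : Connected C
  C-connected u v with ≤-total (toℕ u) (toℕ v)
  ... | inj₁ u≤v = ascendᶠ _ u v u≤v (λ _ _ _ → tt)
  ... | inj₂ v≤u = reverseʷ (ascendᶠ _ v u v≤u (λ _ _ _ → tt))

  -- Removing a vertex w leaves C connected: between u and v (index u ≤
  -- index v) either the direct path avoids w, or w lies strictly between
  -- them and we go the other way round, through the edge 0 — (N-1).
  private
    below : ∀ {x w : Fin N} → toℕ x < toℕ w → x ≢ w
    below x<w x≡w = <⇒≢ x<w (cong toℕ x≡w)

    above : ∀ {x w : Fin N} → toℕ w < toℕ x → x ≢ w
    above w<x x≡w = <⇒≢ w<x (cong toℕ (sym x≡w))

  avoid-ascending : ∀ w u v → u ≢ w → v ≢ w → toℕ u ≤ toℕ v → Walk C (_≢ w) u v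
  avoid-ascending w u v u≢w v≢w u≤v with <-cmp (toℕ w) (toℕ u)
  ... | tri< w<u _ _ = ascendᶠ _ u v u≤v (λ x u≤x _ → above (<-≤-trans w<u u≤x))
  ... | tri≈ _ w≡u _ = ⊥-elim (u≢w (toℕ-injective (sym w≡u)))
  ... | tri> _ _ u<w with <-cmp (toℕ w) (toℕ v)
  ...   | tri> _ _ v<w = ascendᶠ _ u v u≤v (λ x _ x≤v → below (≤-<-trans x≤v v<w))
  ...   | tri≈ _ w≡v _ = ⊥-elim (v≢w (toℕ-injective (sym w≡v)))
  ...   | tri< w<v _ _ =
    reverseʷ (ascendᶠ _ zero u z≤n (λ x _ x≤u → below (≤-<-trans x≤u u<w)))
    ++ʷ step (below (≤-<-trans z≤n u<w)) C-adj-ends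
          (reverseʷ (ascendᶠ _ v last v≤last (λ x v≤x _ → above (<-≤-trans w<v v≤x))))
    where
    v≤last : toℕ v ≤ toℕ last
    v≤last rewrite toℕ-fromℕ (2 + k) = s≤s⁻¹ (toℕ<n v)

  C-noCut : NoCutVertex C
  C-noCut w u v u≢w v≢w with ≤-total (toℕ u) (toℕ v)
  ... | inj₁ u≤v = avoid-ascending w u v u≢w v≢w u≤v
  ... | inj₂ v≤u = reverseʷ (avoid-ascending w v u v≢w u≢w v≤u)

  C-twoConnected : TwoConnected C
  C-twoConnected = C-connected , C-noCut

  -- Every neighbour of a is its successor or its predecessor around the
  -- cycle, and each of these is unique; hence no vertex has degree ≥ 3.
  Successor Predecessor : Fin N → Fin N → Set
  Successor   a x = (suc (toℕ a) ≡ toℕ x) ⊎ (toℕ x ≡ 0 × suc (toℕ a) ≡ N)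
  Predecessor a x = (suc (toℕ x) ≡ toℕ a) ⊎ (toℕ a ≡ 0 × suc (toℕ x) ≡ N)

  neighbour-kind : ∀ {a x} → CycleAdj N a x → Successor a x ⊎ Predecessor a x
  neighbour-kind (inj₁ e)               = inj₁ (inj₁ e)
  neighbour-kind (inj₂ (inj₁ e))        = inj₂ (inj₁ e)
  neighbour-kind (inj₂ (inj₂ (inj₁ e))) = inj₂ (inj₂ e)
  neighbour-kind (inj₂ (inj₂ (inj₂ e))) = inj₁ (inj₂ e)

  successor-unique : ∀ {a x y} → Successor a x → Successor a y → x ≡ y
  successor-unique (inj₁ e₁)       (inj₁ e₂)       = toℕ-injective (trans (sym e₁) e₂)
  successor-unique (inj₂ (e₁ , _)) (inj₂ (e₂ , _)) = toℕ-injective (trans e₁ (sym e₂))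
  successor-unique {x = x} (inj₁ e₁) (inj₂ (_ , e₂)) = ⊥-elim (<⇒≢ (toℕ<n x) (trans (sym e₁) e₂))
  successor-unique {y = y} (inj₂ (_ , e₁)) (inj₁ e₂) = ⊥-elim (<⇒≢ (toℕ<n y) (trans (sym e₂) e₁))

  predecessor-unique : ∀ {a x y} → Predecessor a x → Predecessor a y → x ≡ y
  predecessor-unique (inj₁ e₁)       (inj₁ e₂)       = toℕ-injective (suc-injective (trans e₁ (sym e₂)))
  predecessor-unique (inj₂ (_ , e₁)) (inj₂ (_ , e₂)) = toℕ-injective (suc-injective (trans e₁ (sym e₂)))
  predecessor-unique (inj₁ e₁) (inj₂ (a≡0 , _)) with () ← trans e₁ a≡0
  predecessor-unique (inj₂ (a≡0 , _)) (inj₁ e₂) with () ← trans e₂ a≡0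

  C-degree≤2 : ∀ a → degree C a ≤ 2
  C-degree≤2 a with 3 ≤? degree C a
  ... | no  3≰d = ≤-pred (≰⇒> 3≰d)
  ... | yes 3≤d with triple-neighbours C a 3≤d
  ...   | x , y , z , distinct , ex , ey , ez =
    ⊥-elim (no-triple-in-two-classes (Successor a) (Predecessor a) successor-unique predecessor-unique
              distinct (neighbour-kind (adj-C ex)) (neighbour-kind (adj-C ey)) (neighbour-kind (adj-C ez)))

  Π-C : ∀ i → Π i C ≤ weight i 2 ^ N
  Π-C i rewrite Π-∏ i C | sym (∏-const N (weight i 2)) =
    ∏-mono (λ x → weight-mono i (≤-trans (s≤s z≤n) (degree≥2 C C-twoConnected x)) (C-degree≤2 x))

-- Follow the non-backtracking trail t₀ = 0, t₁, t₂, … ; by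
-- pigeonhole it revisits a vertex, and its first revisit is of t₀ itself
-- (revisiting any other vertex would give that vertex three neighbours).
-- The closed trail t₀ … tₘ is closed under adjacency, hence by
-- connectivity passes through every vertex exactly once, and j ↦ tⱼ is an
-- isomorphism from the standard cycle onto G.
module TwoRegular {n} (G : Graph (suc n)) (connected : Connected G)
  (two-neighbours : ∀ x → Σ (Fin (suc n)) λ w₁ → Σ (Fin (suc n)) λ w₂ →
                      w₁ ≢ w₂ × adj G x w₁ ≡ true × adj G x w₂ ≡ true)
  (no-three-neighbours : ∀ x {a b c} → Distinct₃ a b c →
                      adj G x a ≡ true → adj G x b ≡ true → adj G x c ≡ true → ⊥)
  where

  V : Set
  V = Fin (suc n)

  neighbour-known : ∀ x {a b c} → a ≢ b → adj G x a ≡ true → adj G x b ≡ true →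
                    adj G x c ≡ true → c ≡ a ⊎ c ≡ b
  neighbour-known x {a} {b} {c} a≢b ea eb ec with c ≟ a | c ≟ b
  ... | yes c≡a | _       = inj₁ c≡a
  ... | no _    | yes c≡b = inj₂ c≡b
  ... | no c≢a  | no c≢b  = ⊥-elim (no-three-neighbours x (a≢b , c≢a ∘ sym , c≢b ∘ sym) ea eb ec)

  other-neighbour : ∀ x a → Σ V λ y → adj G x y ≡ true × y ≢ a
  other-neighbour x a with two-neighbours x
  ... | w₁ , w₂ , w₁≢w₂ , e₁ , e₂ with w₁ ≟ a
  ...   | yes refl = w₂ , e₂ , w₁≢w₂ ∘ sym
  ...   | no w₁≢a  = w₁ , e₁ , w₁≢a

  next : V → V → V
  next x a = proj₁ (other-neighbour x a)

  trail-pair : ℕ → V × V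
  trail-pair zero    = zero , next zero zero
  trail-pair (suc j) = proj₂ (trail-pair j) , next (proj₂ (trail-pair j)) (proj₁ (trail-pair j))

  t : ℕ → V
  t j = proj₁ (trail-pair j)

  trail-adj : ∀ j → adj G (t j) (t (suc j)) ≡ true
  trail-adj zero    = proj₁ (proj₂ (other-neighbour zero zero))
  trail-adj (suc j) = proj₁ (proj₂ (other-neighbour (t (suc j)) (t j)))

  trail-adj⁻ : ∀ j → adj G (t (suc j)) (t j) ≡ true
  trail-adj⁻ j = trans (adj-sym G (t (suc j)) (t j)) (trail-adj j)

  trail-turns : ∀ j → t (suc (suc j)) ≢ t j
  trail-turns j = proj₂ (proj₂ (other-neighbour (t (suc j)) (t j)))

  trail-neighbours : ∀ j {c} → adj G (t (suc j)) c ≡ true → c ≡ t j ⊎ c ≡ t (suc (suc j))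
  trail-neighbours j = neighbour-known (t (suc j)) (trail-turns j ∘ sym) (trail-adj⁻ j) (trail-adj (suc j))

  InjectiveUpTo : ℕ → Set
  InjectiveUpTo m = ∀ {i j} → i ≤ m → j ≤ m → t i ≡ t j → i ≡ j

  -- If t₀, …, tₘ are distinct, tₘ₊₁ can only repeat t₀: it differs from
  -- its neighbour tₘ, and tₘ₊₁ = tᵢ₊₁ with i + 1 < m would make tₘ a third
  -- neighbour of tᵢ₊₁ besides tᵢ and tᵢ₊₂.
  first-repeat : ∀ {m} → InjectiveUpTo m → ∀ {i} → i ≤ m → t i ≡ t (suc m) → t (suc m) ≡ t 0
  first-repeat inj {i} i≤m eq with m≤n⇒m<n∨m≡n i≤m
  ... | inj₂ refl = ⊥-elim (adj-≢ G (trail-adj i) eq)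
  first-repeat inj {zero} _ eq | inj₁ _ = sym eq
  first-repeat {m} inj {suc i} _ eq | inj₁ 1+i<m
    with trail-neighbours i (subst (λ z → adj G z (t m) ≡ true) (sym eq) (trail-adj⁻ m))
  ... | inj₁ tₘ≡tᵢ = ⊥-elim (<⇒≢ (≤-trans (n<1+n i) (<⇒≤ 1+i<m))
                                  (sym (inj ≤-refl (≤-trans (n≤1+n i) (<⇒≤ 1+i<m)) tₘ≡tᵢ)))
  ... | inj₂ tₘ≡tᵢ₊₂ with inj ≤-refl 1+i<m tₘ≡tᵢ₊₂
  ...   | refl = ⊥-elim (trail-turns (suc i) (sym eq))

  Closed : ℕ → Set
  Closed m = InjectiveUpTo m × t (suc m) ≡ t 0

  extend : ∀ m → InjectiveUpTo m → InjectiveUpTo (suc m) ⊎ Closed m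
  extend m inj with any? (λ (s : Fin (suc m)) → t (toℕ s) ≟ t (suc m))
  ... | yes (s , eq) = inj₂ (inj , first-repeat inj (s≤s⁻¹ (toℕ<n s)) eq)
  ... | no fresh     = inj₁ inj′
    where
    inj′ : InjectiveUpTo (suc m)
    inj′ i≤1+m j≤1+m eq with m≤n⇒m<n∨m≡n i≤1+m | m≤n⇒m<n∨m≡n j≤1+m
    ... | inj₁ i<1+m | inj₁ j<1+m = inj (s≤s⁻¹ i<1+m) (s≤s⁻¹ j<1+m) eq
    ... | inj₂ refl  | inj₂ refl  = refl
    ... | inj₂ refl  | inj₁ j<1+m =
      ⊥-elim (fresh (fromℕ< j<1+m , trans (cong t (toℕ-fromℕ< j<1+m)) (sym eq)))
    ... | inj₁ i<1+m | inj₂ refl  =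
      ⊥-elim (fresh (fromℕ< i<1+m , trans (cong t (toℕ-fromℕ< i<1+m)) eq))

  follow : ∀ m → InjectiveUpTo m ⊎ Σ ℕ Closed
  follow zero    = inj₁ λ { z≤n z≤n _ → refl }
  follow (suc m) with follow m
  ... | inj₂ closed = inj₂ closed
  ... | inj₁ inj with extend m inj
  ...   | inj₁ inj′   = inj₁ inj′
  ...   | inj₂ closed = inj₂ (m , closed)

  enumerate-injective : ∀ {m} → InjectiveUpTo m → ∀ {s s′ : Fin (suc m)} →
                        t (toℕ s) ≡ t (toℕ s′) → s ≡ s′
  enumerate-injective inj {s} {s′} eq = toℕ-injective (inj (s≤s⁻¹ (toℕ<n s)) (s≤s⁻¹ (toℕ<n s′)) eq)

  -- By pigeonhole, n + 2 trail vertices in V cannot be distinct.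
  trail-closes : Σ ℕ Closed
  trail-closes with follow (suc n)
  ... | inj₂ closed = closed
  ... | inj₁ inj    = ⊥-elim (1+n≰n (injective⇒≤ {f = t ∘ toℕ} (enumerate-injective inj)))

  return-length : ∀ m → t (suc m) ≡ t 0 → 2 ≤ m
  return-length zero          t₁≡t₀ = ⊥-elim (adj-≢ G (trail-adj 0) (sym t₁≡t₀))
  return-length (suc zero)    t₂≡t₀ = ⊥-elim (trail-turns 0 t₂≡t₀)
  return-length (suc (suc _)) _     = s≤s (s≤s z≤n)

  module ClosedTrail (m : ℕ) (inj : InjectiveUpTo m) (returns : t (suc m) ≡ t 0) where

    2≤m : 2 ≤ m
    2≤m = return-length m returns

    closing-adj : adj G (t 0) (t m) ≡ true
    closing-adj = subst (λ z → adj G z (t m) ≡ true) returns (trail-adj⁻ m)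

    start-neighbours : ∀ {c} → adj G (t 0) c ≡ true → c ≡ t 1 ⊎ c ≡ t m
    start-neighbours = neighbour-known (t 0)
      (λ t₁≡tₘ → <⇒≢ 2≤m (inj (≤-trans (s≤s z≤n) 2≤m) ≤-refl t₁≡tₘ)) (trail-adj 0) closing-adj

    OnTrail : V → Set
    OnTrail x = Σ ℕ λ j → j ≤ m × t j ≡ x

    neighbour-on-trail : ∀ j {x} → j ≤ m → adj G (t j) x ≡ true → OnTrail x
    neighbour-on-trail zero _ e with start-neighbours e
    ... | inj₁ x≡t₁ = 1 , ≤-trans (s≤s z≤n) 2≤m , sym x≡t₁
    ... | inj₂ x≡tₘ = m , ≤-refl , sym x≡tₘ
    neighbour-on-trail (suc j) 1+j≤m e with trail-neighbours j e
    ... | inj₁ x≡tⱼ = j , ≤-trans (n≤1+n j) 1+j≤m , sym x≡tⱼ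
    ... | inj₂ x≡tⱼ₊₂ with m≤n⇒m<n∨m≡n 1+j≤m
    ...   | inj₁ 2+j≤m = suc (suc j) , 2+j≤m , sym x≡tⱼ₊₂
    ...   | inj₂ refl  = 0 , z≤n , sym (trans x≡tⱼ₊₂ returns)

    walk-on-trail : ∀ {Q : V → Set} {u v} → Walk G Q u v → OnTrail u → OnTrail v
    walk-on-trail (here _)     onTrail          = onTrail
    walk-on-trail (step _ e w) (j , j≤m , refl) = walk-on-trail w (neighbour-on-trail j j≤m e)

    on-trail : ∀ x → OnTrail x
    on-trail x = walk-on-trail (connected (t 0) x) (0 , z≤n , refl)

    pos : V → ℕ
    pos x = proj₁ (on-trail x)

    pos≤m : ∀ x → pos x ≤ m
    pos≤m x = proj₁ (proj₂ (on-trail x))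

    t-pos : ∀ x → t (pos x) ≡ x
    t-pos x = proj₂ (proj₂ (on-trail x))

    index : V → Fin (suc m)
    index x = fromℕ< (s≤s (pos≤m x))

    t-index : ∀ x → t (toℕ (index x)) ≡ x
    t-index x = trans (cong t (toℕ-fromℕ< (s≤s (pos≤m x)))) (t-pos x)

    index-injective : ∀ {x y} → index x ≡ index y → x ≡ y
    index-injective {x} {y} eq = trans (sym (t-index x)) (trans (cong (t ∘ toℕ) eq) (t-index y))

    trail-length : suc m ≡ suc n
    trail-length = ≤-antisym
      (injective⇒≤ {f = t ∘ toℕ} (enumerate-injective inj))
      (injective⇒≤ {f = index} index-injective)

    -- Adjacency of positions in the closed trail is that of the standard
    -- cycle (IndexAdj A B unfolds CycleAdj (n + 1) on the indices A, B).
    IndexAdj : ℕ → ℕ → Set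
    IndexAdj A B =
      (suc A ≡ B) ⊎ (suc B ≡ A) ⊎ ((A ≡ 0 × suc B ≡ suc n) ⊎ (B ≡ 0 × suc A ≡ suc n))

    adj⇒index-adj : ∀ {A B} → A ≤ m → B ≤ m → adj G (t A) (t B) ≡ true → IndexAdj A B
    adj⇒index-adj {zero} {B} _ B≤m e with start-neighbours e
    ... | inj₁ t-B≡t₁ = inj₁ (sym (inj B≤m (≤-trans (s≤s z≤n) 2≤m) t-B≡t₁))
    ... | inj₂ t-B≡tₘ with inj B≤m ≤-refl t-B≡tₘ
    ...   | refl = inj₂ (inj₂ (inj₁ (refl , trail-length)))
    adj⇒index-adj {suc A} {B} 1+A≤m B≤m e with trail-neighbours A e
    ... | inj₁ t-B≡t-A = inj₂ (inj₁ (cong suc (inj B≤m (≤-trans (n≤1+n A) 1+A≤m) t-B≡t-A)))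
    ... | inj₂ t-B≡t-A+2 with m≤n⇒m<n∨m≡n 1+A≤m
    ...   | inj₁ 2+A≤m = inj₁ (sym (inj B≤m 2+A≤m t-B≡t-A+2))
    ...   | inj₂ refl  = inj₂ (inj₂ (inj₂ (inj B≤m z≤n (trans t-B≡t-A+2 returns) , trail-length)))

    index-adj⇒adj : ∀ {A B} → IndexAdj A B → adj G (t A) (t B) ≡ true
    index-adj⇒adj {A}     (inj₁ refl)        = trail-adj A
    index-adj⇒adj {B = B} (inj₂ (inj₁ refl)) = trail-adj⁻ B
    index-adj⇒adj (inj₂ (inj₂ (inj₁ (refl , 1+B≡1+n))))
      with refl ← suc-injective (trans 1+B≡1+n (sym trail-length)) = closing-adj
    index-adj⇒adj (inj₂ (inj₂ (inj₂ (refl , 1+A≡1+n))))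
      with refl ← suc-injective (trans 1+A≡1+n (sym trail-length)) = trans (adj-sym G (t m) (t 0)) closing-adj

    ≤m : ∀ (a : V) → toℕ a ≤ m
    ≤m a = s≤s⁻¹ (subst (toℕ a <_) (sym trail-length) (toℕ<n a))

    pos<1+n : ∀ x → pos x < suc n
    pos<1+n x = subst (pos x <_) trail-length (s≤s (pos≤m x))

    position : V → V
    position x = fromℕ< (pos<1+n x)

    enumeration : V ↔ V
    enumeration = mk↔ₛ′ (t ∘ toℕ) position
      (λ x → trans (cong t (toℕ-fromℕ< (pos<1+n x))) (t-pos x))
      (λ a → toℕ-injective (trans (toℕ-fromℕ< (pos<1+n (t (toℕ a))))
                                  (inj (pos≤m (t (toℕ a))) (≤m a) (t-pos (t (toℕ a))))))

    isCycle : IsCycle G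
    isCycle = enumeration , λ a b → mk⇔ (adj⇒index-adj (≤m a) (≤m b)) index-adj⇒adj

  twoRegular-cycle : IsCycle G
  twoRegular-cycle = let (m , inj , returns) = trail-closes in ClosedTrail.isCycle m inj returns

Π-above-cycle : ∀ i {k} (G : Graph (3 + k)) → TwoConnected G →
                ∀ u → 3 ≤ degree G u → weight i 2 ^ (3 + k) < Π i G
Π-above-cycle i {k} G tc u 3≤d rewrite Π-∏ i G | sym (∏-const (3 + k) (weight i 2)) =
  ∏-strict (λ _ → weight-positive i (s≤s z≤n))
           (λ x → weight-mono i (s≤s z≤n) (degree≥2 G tc x)) u
           (weight-strict i (s≤s z≤n) 3≤d)

-- Part (ii): in a minimiser of Π i no vertex has three neighbours (else Π i
-- would exceed Π i C_N), and every vertex has two, so it is a cycle.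
minimiser-cycle : ∀ {k} i (G : Graph (3 + k)) → TwoConnected G →
  ((H : Graph (3 + k)) → TwoConnected H → Π i G ≤ Π i H) → IsCycle G
minimiser-cycle {k} i G tc minimal =
  TwoRegular.twoRegular-cycle G (proj₁ tc) (two-neighbours G tc) no-three-neighbours
  where
  open StandardCycle k using (C; C-twoConnected; Π-C)

  no-three-neighbours : ∀ x {a b c} → Distinct₃ a b c →
    adj G x a ≡ true → adj G x b ≡ true → adj G x c ≡ true → ⊥
  no-three-neighbours x distinct ea eb ec =
    <⇒≱ (Π-above-cycle i G tc x (degree-triple G x distinct ea eb ec))
        (≤-trans (minimal C C-twoConnected) (Π-C i))

lemma2p2 : (n : ℕ) → 3 ≤ n → (i : Idx) →
    ((G : Graph n) → TwoConnected G →
       ((H : Graph n) → TwoConnected H → Π i H ≤ Π i G) → IsComplete G)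
    × ((G : Graph n) → TwoConnected G →
       ((H : Graph n) → TwoConnected H → Π i G ≤ Π i H) → IsCycle G)
lemma2p2 (suc (suc (suc k))) (s≤s (s≤s (s≤s z≤n))) i =
  maximiser-complete i , minimiser-cycle i
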